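{- Let $\mathfrak{G}=(Y,R,E)$ be a descriptive $\mathsf{MS4}$-frame and $Q=E\circ R$. Then (1) $E[\operatorname{qmax}Y]=E_Q[\operatorname{qmax}Y]$; (2) $\mathfrak{G}$ satisfies the global Kuroda principle if and only if for every $x\in\operatorname{qmax}Y$ we have $E_Q[x]\subseteq\operatorname{qmax}Y$ (equivalently, $E_Q[\operatorname{qmax}Y]=\operatorname{qmax}Y$).
   Context: An $\mathsf{MS4}$-frame is $(Y,R,E)$ with $R$ a quasi-order, $E$ an equivalence relation, and: if $xEy$ and $yRz$ then $xRu$ and $uEz$ for some $u$. It is descriptive if $Y$ carries a Stone topology in which $R$ and $E$ are continuous ($S[x]=\{y:xSy\}$ closed for all $x$, $S^{ -1}[U]$ clopen for clopen $U$). $xQy$ iff $xRz$ and $zEy$ for some $z$; $xE_Qy$ iff $xQy$ and $yQx$; for $A\subseteq Y$ and a relation $S$, $S[A]=\{y:\exists a\in A,\ aSy\}$. $\operatorname{qmax}Y=\{x:xRy\Rightarrow yRx\}$. Global Kuroda principle: $E[x]\subseteq\operatorname{qmax}Y$ for every $x\in\operatorname{qmax}Y$. -}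

module Defs where

open import Level using (0ℓ)
open import Data.Product using (Σ; ∃; _×_; _,_)
open import Data.List using (List)
open import Data.List.Membership.Propositional using () renaming (_∈_ to _∈ˡ_)
open import Relation.Binary using (Rel; IsPreorder; IsEquivalence)
open import Relation.Binary.PropositionalEquality using (_≡_)
open import Relation.Unary using (Pred; _∈_; _⊆_; _≐_; ∁)
open import Relation.Nullary using (¬_)
open import Data.Empty using (⊥)

Subset : Set → Set₁
Subset Y = Pred Y 0ℓ

record Topology (Y : Set) : Set₁ where
  field
    Open       : Subset Y → Set
    open-ext   : ∀ {U V} → U ≐ V → Open U → Open V
    open-whole : Open (λ _ → Y)
    open-∩     : ∀ {U V} → Open U → Open V → Open (λ y → U y × V y)
    open-⋃     : (I : Set) (U : I → Subset Y) → (∀ i → Open (U i))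
                 → Open (λ y → Σ I λ i → U i y)

  Closed : Subset Y → Set
  Closed U = Open (∁ U)

  Clopen : Subset Y → Set
  Clopen U = Open U × Closed U

record IsStone {Y : Set} (τ : Topology Y) : Set₁ where
  open Topology τ
  field
    compact : (I : Set) (U : I → Subset Y) → (∀ i → Open (U i))
              → (∀ y → Σ I λ i → U i y)
              → Σ (List I) λ is → ∀ y → Σ I λ i → (i ∈ˡ is) × U i y
    hausdorff : ∀ x y → ¬ (x ≡ y) →
                Σ (Subset Y) λ U → Σ (Subset Y) λ V →
                  Open U × Open V × U x × V y × (∀ z → U z → V z → ⊥)
    zero-dim  : ∀ U → Open U → ∀ x → U x →
                Σ (Subset Y) λ C → Clopen C × C x × C ⊆ U

_[_] : ∀ {Y : Set} → Rel Y 0ℓ → Subset Y → Subset Y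
(S [ A ]) y = ∃ λ a → A a × S a y

_[_]ₚ : ∀ {Y : Set} → Rel Y 0ℓ → Y → Subset Y
(S [ x ]ₚ) y = S x y

_⁻¹[_] : ∀ {Y : Set} → Rel Y 0ℓ → Subset Y → Subset Y
(S ⁻¹[ U ]) x = ∃ λ y → S x y × U y

record IsContinuous {Y : Set} (τ : Topology Y) (S : Rel Y 0ℓ) : Set₁ where
  open Topology τ
  field
    point-closed : ∀ x → Closed (S [ x ]ₚ)
    preimage-clopen : ∀ U → Clopen U → Clopen (S ⁻¹[ U ])

record IsMS4Frame {Y : Set} (R E : Rel Y 0ℓ) : Set where
  field
    R-quasiorder : IsPreorder _≡_ R
    E-equiv      : IsEquivalence E
    commute      : ∀ {x y z} → E x y → R y z → ∃ λ u → R x u × E u z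

record IsDescriptiveMS4Frame {Y : Set} (R E : Rel Y 0ℓ) : Set₁ where
  field
    ms4       : IsMS4Frame R E
    topology  : Topology Y
    stone     : IsStone topology
    R-cont    : IsContinuous topology R
    E-cont    : IsContinuous topology E

Qrel : ∀ {Y : Set} → Rel Y 0ℓ → Rel Y 0ℓ → Rel Y 0ℓ
Qrel R E x y = ∃ λ z → R x z × E z y

EQrel : ∀ {Y : Set} → Rel Y 0ℓ → Rel Y 0ℓ → Rel Y 0ℓ
EQrel R E x y = Qrel R E x y × Qrel R E y x

qmax : ∀ {Y : Set} → Rel Y 0ℓ → Subset Y
qmax R x = ∀ y → R x y → R y x

GlobalKuroda : ∀ {Y : Set} → Rel Y 0ℓ → Rel Y 0ℓ → Set
GlobalKuroda R E = ∀ x → x ∈ qmax R → (E [ x ]ₚ) ⊆ qmax R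

-- Hence an E_Q-successor of a quasi-maximal x is an E-successor of the quasi-maximal
-- point z with x R z, which turns each E_Q-condition into the corresponding E-condition.
module Submission where

open import Defs
open import Level using (0ℓ)
open import Data.Product using (_×_; _,_; proj₁)
open import Function.Bundles using (_⇔_; mk⇔)
open import Relation.Binary using (Rel; IsPreorder; IsEquivalence; Transitive)
open import Relation.Binary.PropositionalEquality using (_≡_; refl)
open import Relation.Unary using (_∈_; _⊆_; _≐_)

qmax-upward-closed : ∀ {Y : Set} {R : Rel Y 0ℓ} → Transitive R →
                     ∀ {x y} → x ∈ qmax R → R x y → y ∈ qmax R
qmax-upward-closed trans qx xy z yz = trans (qx z (trans xy yz)) xy

module _ {Y : Set} {R E : Rel Y 0ℓ}
         (R-preorder : IsPreorder _≡_ R) (E-equivalence : IsEquivalence E) where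

  open IsPreorder R-preorder using () renaming (reflexive to R-reflexive; trans to R-trans)
  open IsEquivalence E-equivalence using () renaming (refl to E-refl; sym to E-sym)

  E⊆EQ : ∀ {x y} → E x y → EQrel R E x y
  E⊆EQ xy = (_ , R-reflexive refl , xy) , (_ , R-reflexive refl , E-sym xy)

  EQ-from-qmax⇒E-from-qmax : ∀ {x y} → x ∈ qmax R → EQrel R E x y →
                              (E [ qmax R ]) y
  EQ-from-qmax⇒E-from-qmax qx ((z , xz , zy) , _) =
    z , qmax-upward-closed R-trans qx xz , zy

  E-image-qmax≐EQ-image-qmax : (E [ qmax R ]) ≐ (EQrel R E [ qmax R ])
  E-image-qmax≐EQ-image-qmax =
      (λ { (x , qx , xy) → x , qx , E⊆EQ xy })
    , (λ { (x , qx , xy) → EQ-from-qmax⇒E-from-qmax qx xy })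

  GlobalKuroda⇔EQ-Kuroda :
    GlobalKuroda R E ⇔ (∀ x → x ∈ qmax R → (EQrel R E [ x ]ₚ) ⊆ qmax R)
  GlobalKuroda⇔EQ-Kuroda = mk⇔
    (λ kuroda x qx {_} xy → let (z , qz , zy) = EQ-from-qmax⇒E-from-qmax qx xy
                        in kuroda z qz zy)
    (λ eq-kuroda x qx {_} xy → eq-kuroda x qx (E⊆EQ xy))

  EQ-Kuroda⇔EQ-image-qmax≐qmax :
    (∀ x → x ∈ qmax R → (EQrel R E [ x ]ₚ) ⊆ qmax R) ⇔ ((EQrel R E [ qmax R ]) ≐ qmax R)
  EQ-Kuroda⇔EQ-image-qmax≐qmax = mk⇔
    (λ eq-kuroda → (λ { {_} (x , qx , xy) → eq-kuroda x qx xy })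
                 , (λ {x} qx → x , qx , E⊆EQ E-refl))
    (λ image≐qmax x qx {_} xy → proj₁ image≐qmax (x , qx , xy))

lemma3p10 : {Y : Set} (R E : Rel Y 0ℓ) → IsDescriptiveMS4Frame R E →
    ((E [ qmax R ]) ≐ (EQrel R E [ qmax R ]))
    × (GlobalKuroda R E ⇔ (∀ x → x ∈ qmax R → (EQrel R E [ x ]ₚ) ⊆ qmax R))
    × ((∀ x → x ∈ qmax R → (EQrel R E [ x ]ₚ) ⊆ qmax R) ⇔ ((EQrel R E [ qmax R ]) ≐ qmax R))
lemma3p10 R E frame =
    E-image-qmax≐EQ-image-qmax R-quasiorder E-equiv
  , GlobalKuroda⇔EQ-Kuroda R-quasiorder E-equiv
  , EQ-Kuroda⇔EQ-image-qmax≐qmax R-quasiorder E-equiv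
  where open IsMS4Frame (IsDescriptiveMS4Frame.ms4 frame)
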